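{- Let $\mathcal T$ be a finite forest of base types and $P$ an annotated $\pi$-term. If every $Q\in\mathrm{Reach}(P)$ is $\mathcal T$-compatible, then $P$ is depth-bounded.
   Context: \textbf{Syntax.} $\pi$-terms over an infinite set of names: $P ::= \nu x.P \mid P_1\parallel P_2 \mid M \mid\, !M$, $M ::= \mathbf 0 \mid M+M \mid \pi.P$, $\pi ::= a(x)\mid \overline a\langle b\rangle \mid \tau$; $M$, $!M$ are sequential; $\mathrm{fn}$ denotes free names. Structural congruence $\equiv$: smallest congruence containing $\alpha$-conversion, commutativity/associativity of $+$, $\parallel$ with neutral $\mathbf 0$, $\nu x.\mathbf 0\equiv\mathbf 0$, $\nu x.\nu y.P\equiv\nu y.\nu x.P$, $!\mathbf 0\equiv\mathbf 0$, $!M\equiv M\parallel!M$, $P\parallel\nu a.Q\equiv\nu a.(P\parallel Q)$ if $a\notin\mathrm{fn}(P)$. Reduction $\to$: $P\to Q$ iff either $P\equiv\nu W.(S\parallel R\parallel C)$ with $S=(\overline a\langle b\rangle.\nu Y_s.S')+M_s$, $R=(a(x).\nu Y_r.R')+M_r$ and $Q\equiv\nu WY_sY_r.(S'\parallel R'\{b/x\}\parallel C)$, or $P\equiv\nu W.(\tau.\nu Y.P'\parallel C)$ and $Q\equiv\nu WY.(P'\parallel C)$ (where the left-hand sides are in normal form, i.e. restrictions outermost, each name bound at most once). $\mathrm{Reach}(P)=\{Q\mid P\to^*Q\}$. \textbf{Depth.} $\mathrm{nest}_\nu(M)=\mathrm{nest}_\nu(!M)=0$, $\mathrm{nest}_\nu(\nu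 x.P)=1+\mathrm{nest}_\nu(P)$, $\mathrm{nest}_\nu(P\parallel Q)=\max(\mathrm{nest}_\nu(P),\mathrm{nest}_\nu(Q))$; $\mathrm{depth}(P)=\min\{\mathrm{nest}_\nu(Q)\mid Q\equiv P\}$; $P$ is depth-bounded if $\exists k\,\forall Q\in\mathrm{Reach}(P)$, $\mathrm{depth}(Q)\le k$. \textbf{Types.} $(\mathcal T,\lessdot)$ is a finite forest ($t_1\lessdot t_2$: $t_1$ parent of $t_2$), $<$ its transitive closure. Types $\tau ::= t\mid t[\tau]$, $\mathrm{base}(t)=\mathrm{base}(t[\tau])=t$. Annotated terms have restrictions $\nu(x{:}\tau)$; congruence and reduction copy annotations. \textbf{$\mathcal T$-compatibility.} $\mathrm{forest}(\nu(x{:}\tau).Q)$ is a root labelled $(x,\mathrm{base}(\tau))$ with the roots of $\mathrm{forest}(Q)$ as children; $\mathrm{forest}(Q_1\parallel Q_2)$ disjoint union; sequential $Q$ gives a single node labelled $Q$; $\mathrm{forest}(\mathbf 0)$ empty. A forest is $\mathcal T$-compatible if along every path $n_1\cdots n_kn$ (parent to child) with $n$ labelled by a sequential term and $n_i$ labelled $(x_i,t_i)$, $t_1<\cdots<t_k$. $P$ is $\mathcal T$-compatible if $\mathrm{forest}(Q)$ is $\mathcal T$-compatible for some $Q\equiv P$. -}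

module Defs where

open import Data.Nat using (ℕ; zero; suc; _≤_; _⊔_; _≟_)
open import Data.Fin using (Fin)
open import Data.Maybe using (Maybe; just; nothing)
open import Data.List using (List; []; _∷_; _++_; filter)
open import Data.List.Membership.Propositional using (_∈_; _∉_)
open import Data.List.Relation.Unary.Linked using (Linked)
open import Data.Product using (Σ; ∃; _×_; _,_)
open import Relation.Nullary using (¬_; yes; no; ¬?)
open import Relation.Binary.PropositionalEquality using (_≡_; _≢_)
open import Relation.Binary.Construct.Closure.Transitive using (TransClosure)
open import Relation.Binary.Construct.Closure.ReflexiveTransitive using (Star)

ParentRel : {n : ℕ} → (Fin n → Maybe (Fin n)) → Fin n → Fin n → Set
ParentRel par t₁ t₂ = par t₂ ≡ just t₁

record Forest : Set where
  field
    size    : ℕ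
    parent  : Fin size → Maybe (Fin size)
    acyclic : ∀ t → ¬ TransClosure (ParentRel parent) t t

  Node : Set
  Node = Fin size

  _⋖_ : Node → Node → Set
  _⋖_ = ParentRel parent

  _<ᵀ_ : Node → Node → Set
  _<ᵀ_ = TransClosure _⋖_

open Forest public

Name : Set
Name = ℕ

data Ty (B : Set) : Set where
  bt  : B → Ty B
  app : B → Ty B → Ty B

base : {B : Set} → Ty B → B
base (bt t)    = t
base (app t _) = t

data Act : Set where
  inp : Name → Name → Act
  out : Name → Name → Act
  tau : Act

mutual
  data Proc (B : Set) : Set where
    ν    : Name → Ty B → Proc B → Proc B
    _∥_  : Proc B → Proc B → Proc B
    seq  : Sum B → Proc B
    bang : Sum B → Proc B

  data Sum (B : Set) : Set where
    𝟘   : Sum B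
    _⊕_ : Sum B → Sum B → Sum B
    _·_ : Act → Proc B → Sum B

infixr 5 _∥_
infixr 6 _⊕_
infix  7 _·_

𝟎 : {B : Set} → Proc B
𝟎 = seq 𝟘

_∖_ : List Name → Name → List Name
xs ∖ y = filter (λ z → ¬? (z ≟ y)) xs

mutual
  fn : {B : Set} → Proc B → List Name
  fn (ν x _ P) = fn P ∖ x
  fn (P ∥ Q)   = fn P ++ fn Q
  fn (seq M)   = fnS M
  fn (bang M)  = fnS M

  fnS : {B : Set} → Sum B → List Name
  fnS 𝟘             = []
  fnS (M ⊕ N)       = fnS M ++ fnS N
  fnS (inp a x · P) = a ∷ (fn P ∖ x)
  fnS (out a b · P) = a ∷ b ∷ fn P
  fnS (tau · P)     = fn P

mutual
  bn : {B : Set} → Proc B → List Name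
  bn (ν x _ P) = x ∷ bn P
  bn (P ∥ Q)   = bn P ++ bn Q
  bn (seq M)   = bnS M
  bn (bang M)  = bnS M

  bnS : {B : Set} → Sum B → List Name
  bnS 𝟘             = []
  bnS (M ⊕ N)       = bnS M ++ bnS N
  bnS (inp a x · P) = x ∷ bn P
  bnS (out a b · P) = bn P
  bnS (tau · P)     = bn P

rn : Name → Name → Name → Name
rn b x y with y ≟ x
... | yes _ = b
... | no  _ = y

-- It stops at
-- binders of x; it is capture-avoiding whenever b ∉ bn P, which is
-- required at every use below (always achievable by α-conversion).
mutual
  _[_/_] : {B : Set} → Proc B → Name → Name → Proc B
  ν y τ P [ b / x ] with y ≟ x
  ... | yes _ = ν y τ P
  ... | no  _ = ν y τ (P [ b / x ])
  (P ∥ Q) [ b / x ] = (P [ b / x ]) ∥ (Q [ b / x ])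
  seq M   [ b / x ] = seq (M [ b / x ]ₛ)
  bang M  [ b / x ] = bang (M [ b / x ]ₛ)

  _[_/_]ₛ : {B : Set} → Sum B → Name → Name → Sum B
  𝟘 [ b / x ]ₛ = 𝟘
  (M ⊕ N) [ b / x ]ₛ = (M [ b / x ]ₛ) ⊕ (N [ b / x ]ₛ)
  (inp a y · P) [ b / x ]ₛ with y ≟ x
  ... | yes _ = inp (rn b x a) y · P
  ... | no  _ = inp (rn b x a) y · (P [ b / x ])
  (out a c · P) [ b / x ]ₛ = out (rn b x a) (rn b x c) · (P [ b / x ])
  (tau · P) [ b / x ]ₛ = tau · (P [ b / x ])

mutual
  data _≈_ {B : Set} : Proc B → Proc B → Set where
    ≈refl  : ∀ {P} → P ≈ P
    ≈sym   : ∀ {P Q} → P ≈ Q → Q ≈ P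
    ≈trans : ∀ {P Q R} → P ≈ Q → Q ≈ R → P ≈ R
    ν-cong    : ∀ {x τ P Q} → P ≈ Q → ν x τ P ≈ ν x τ Q
    ∥-cong    : ∀ {P P′ Q Q′} → P ≈ P′ → Q ≈ Q′ → (P ∥ Q) ≈ (P′ ∥ Q′)
    seq-cong  : ∀ {M N} → M ≈ₛ N → seq M ≈ seq N
    bang-cong : ∀ {M N} → M ≈ₛ N → bang M ≈ bang N
    α-ν : ∀ {x y τ P} → y ∉ fn P → y ∉ bn P → ν x τ P ≈ ν y τ (P [ y / x ])
    ∥-comm  : ∀ {P Q} → (P ∥ Q) ≈ (Q ∥ P)
    ∥-assoc : ∀ {P Q R} → ((P ∥ Q) ∥ R) ≈ (P ∥ (Q ∥ R))
    ∥-unit  : ∀ {P} → (P ∥ 𝟎) ≈ P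
    ν-𝟎 : ∀ {x τ} → ν x τ 𝟎 ≈ 𝟎
    ν-swap : ∀ {x σ y τ P} → ν x σ (ν y τ P) ≈ ν y τ (ν x σ P)
    bang-𝟎 : bang 𝟘 ≈ 𝟎
    bang-unfold : ∀ {M} → bang M ≈ (seq M ∥ bang M)
    extrude : ∀ {a τ P Q} → a ∉ fn P → (P ∥ ν a τ Q) ≈ ν a τ (P ∥ Q)

  data _≈ₛ_ {B : Set} : Sum B → Sum B → Set where
    ≈ₛrefl  : ∀ {M} → M ≈ₛ M
    ≈ₛsym   : ∀ {M N} → M ≈ₛ N → N ≈ₛ M
    ≈ₛtrans : ∀ {M N K} → M ≈ₛ N → N ≈ₛ K → M ≈ₛ K
    ⊕-cong  : ∀ {M M′ N N′} → M ≈ₛ M′ → N ≈ₛ N′ → (M ⊕ N) ≈ₛ (M′ ⊕ N′)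
    ·-cong  : ∀ {π P Q} → P ≈ Q → (π · P) ≈ₛ (π · Q)
    α-inp : ∀ {a x y P} → y ∉ fn P → y ∉ bn P →
            (inp a x · P) ≈ₛ (inp a y · (P [ y / x ]))
    ⊕-comm  : ∀ {M N} → (M ⊕ N) ≈ₛ (N ⊕ M)
    ⊕-assoc : ∀ {M N K} → ((M ⊕ N) ⊕ K) ≈ₛ (M ⊕ (N ⊕ K))
    ⊕-unit  : ∀ {M} → (M ⊕ 𝟘) ≈ₛ M

νs : {B : Set} → List (Name × Ty B) → Proc B → Proc B
νs []             P = P
νs ((x , τ) ∷ W) P = ν x τ (νs W P)

data _⟶_ {B : Set} : Proc B → Proc B → Set where
  comm : ∀ {P Q} (W : List (Name × Ty B)) (a b x : Name)
           (P₁ P₂ C : Proc B) (Ms Mr : Sum B) →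
         P ≈ νs W (seq ((out a b · P₁) ⊕ Ms) ∥ seq ((inp a x · P₂) ⊕ Mr) ∥ C) →
         b ∉ bn P₂ →
         Q ≈ νs W (P₁ ∥ (P₂ [ b / x ]) ∥ C) →
         P ⟶ Q
  tau : ∀ {P Q} (W : List (Name × Ty B)) (P₁ C : Proc B) →
        P ≈ νs W (seq (tau · P₁) ∥ C) →
        Q ≈ νs W (P₁ ∥ C) →
        P ⟶ Q

Reach : {B : Set} → Proc B → Proc B → Set
Reach P Q = Star _⟶_ P Q

nestν : {B : Set} → Proc B → ℕ
nestν (ν _ _ P) = suc (nestν P)
nestν (P ∥ Q)   = nestν P ⊔ nestν Q
nestν (seq _)   = 0
nestν (bang _)  = 0

-- depth(P) ≤ k, where depth(P) = min { nestν Q | Q ≡ P }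
DepthAtMost : {B : Set} → ℕ → Proc B → Set
DepthAtMost k P = ∃ λ Q → (Q ≈ P) × (nestν Q ≤ k)

DepthBounded : {B : Set} → Proc B → Set
DepthBounded P = ∃ λ k → ∀ Q → Reach P Q → DepthAtMost k Q

-- Sequential nodes of forest(Q): every sequential subterm except 0
-- (forest(0) is empty).
NonZero𝟘 : {B : Set} → Sum B → Set
NonZero𝟘 M = M ≢ 𝟘

-- RootPath Q ts : a downward path in forest(Q) starting at a root and
-- ending at a node labelled by a sequential term, where ts lists the base
-- types of the restriction nodes (x , t) met along the way.
data RootPath {B : Set} : Proc B → List B → Set where
  pν    : ∀ {x τ P ts} → RootPath P ts → RootPath (ν x τ P) (base τ ∷ ts)
  p∥ˡ   : ∀ {P Q ts} → RootPath P ts → RootPath (P ∥ Q) ts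
  p∥ʳ   : ∀ {P Q ts} → RootPath Q ts → RootPath (P ∥ Q) ts
  pseq  : ∀ {M} → NonZero𝟘 M → RootPath (seq M) []
  pbang : ∀ {M} → RootPath (bang M) []

-- Path Q ts : any downward (parent-to-child) path in forest(Q) ending at a
-- sequential node.
data Path {B : Set} : Proc B → List B → Set where
  here  : ∀ {P ts} → RootPath P ts → Path P ts
  downν : ∀ {x τ P ts} → Path P ts → Path (ν x τ P) ts
  down∥ˡ : ∀ {P Q ts} → Path P ts → Path (P ∥ Q) ts
  down∥ʳ : ∀ {P Q ts} → Path Q ts → Path (P ∥ Q) ts

ForestCompatible : (T : Forest) → Proc (Node T) → Set
ForestCompatible T Q = ∀ ts → Path Q ts → Linked (_<ᵀ_ T) ts

Compatible : (T : Forest) → Proc (Node T) → Set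
Compatible T P = ∃ λ Q → (Q ≈ P) × ForestCompatible T Q

-- Dropping the restrictions that bind over empty subterms (ν x.0 ≡ 0) gives a
-- congruent term whose ν-nesting is the number of restrictions met along one
-- root path to a sequential node.  In a T-compatible forest the base types on
-- such a path form a strictly increasing chain in T, and since T is finite and
-- acyclic, pigeonhole bounds its length by |T|.  So every reachable term has
-- depth at most |T|.
module Submission where

open import Defs

open import Level using (Level)
open import Data.Nat using (ℕ; _≤_; z≤n; s≤s)
open import Data.Nat.Properties using (≤-total; ⊔-lub; ≤-trans; _≤?_; ≰⇒>)
open import Data.Fin as Fin using (Fin; zero; suc)
open import Data.Fin.Properties using (pigeonhole)
open import Data.List using ([]; _∷_; length; lookup)
open import Data.List.Relation.Unary.Linked using (Linked; _∷_)
open import Data.Product using (∃; _×_; _,_)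
open import Data.Sum using (_⊎_; inj₁; inj₂)
open import Relation.Nullary using (yes; no; contradiction)
open import Relation.Binary.Core using (Rel)
open import Relation.Binary.Definitions using (Transitive; Irreflexive)
open import Relation.Binary.PropositionalEquality using (_≡_; refl)
open import Relation.Binary.Construct.Closure.Transitive using (transitive)

module _ {ℓ : Level} {n : ℕ} {R : Rel (Fin n) ℓ} (trans : Transitive R) where

  Linked-lookup : ∀ {xs} → Linked R xs → ∀ {i j} → i Fin.< j →
                  R (lookup xs i) (lookup xs j)
  Linked-lookup (r ∷ _)  {zero}  {suc zero}    _       = r
  Linked-lookup (r ∷ rs) {zero}  {suc (suc j)} _       =
    trans r (Linked-lookup rs {zero} {suc j} (s≤s z≤n))
  Linked-lookup (_ ∷ rs) {suc i} {suc j}       (s≤s p) = Linked-lookup rs p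

  Linked-length≤ : Irreflexive _≡_ R → ∀ {xs} → Linked R xs → length xs ≤ n
  Linked-length≤ irrefl {xs} rs with length xs ≤? n
  ... | yes bounded = bounded
  ... | no  tooLong with pigeonhole (≰⇒> tooLong) (lookup xs)
  ...   | i , j , i<j , xsᵢ≡xsⱼ = contradiction (Linked-lookup rs i<j) (irrefl xsᵢ≡xsⱼ)

module _ {B : Set} where

  PathBoundedForm : Proc B → Set
  PathBoundedForm P = ∃ λ Q → Q ≈ P × ∃ λ ts → RootPath P ts × nestν Q ≤ length ts

  𝟎≈⊎pathBoundedForm : ∀ P → P ≈ 𝟎 ⊎ PathBoundedForm P
  𝟎≈⊎pathBoundedForm (ν x τ P) with 𝟎≈⊎pathBoundedForm P
  ... | inj₁ P≈𝟎 = inj₁ (≈trans (ν-cong P≈𝟎) ν-𝟎)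
  ... | inj₂ (Q , Q≈P , ts , rp , le) =
    inj₂ (ν x τ Q , ν-cong Q≈P , base τ ∷ ts , pν rp , s≤s le)
  𝟎≈⊎pathBoundedForm (P ∥ Q) with 𝟎≈⊎pathBoundedForm P | 𝟎≈⊎pathBoundedForm Q
  ... | inj₁ P≈𝟎 | inj₁ Q≈𝟎 = inj₁ (≈trans (∥-cong P≈𝟎 Q≈𝟎) ∥-unit)
  ... | inj₁ P≈𝟎 | inj₂ (Q′ , Q′≈Q , us , rq , le) =
    inj₂ (𝟎 ∥ Q′ , ∥-cong (≈sym P≈𝟎) Q′≈Q , us , p∥ʳ rq , le)
  ... | inj₂ (P′ , P′≈P , ts , rp , le) | inj₁ Q≈𝟎 =
    inj₂ (P′ ∥ 𝟎 , ∥-cong P′≈P (≈sym Q≈𝟎) , ts , p∥ˡ rp , ⊔-lub le z≤n)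
  ... | inj₂ (P′ , P′≈P , ts , rp , le) | inj₂ (Q′ , Q′≈Q , us , rq , le′)
    with ≤-total (length ts) (length us)
  ...   | inj₁ ts≤us =
    inj₂ (P′ ∥ Q′ , ∥-cong P′≈P Q′≈Q , us , p∥ʳ rq , ⊔-lub (≤-trans le ts≤us) le′)
  ...   | inj₂ us≤ts =
    inj₂ (P′ ∥ Q′ , ∥-cong P′≈P Q′≈Q , ts , p∥ˡ rp , ⊔-lub le (≤-trans le′ us≤ts))
  𝟎≈⊎pathBoundedForm (seq 𝟘)       = inj₁ ≈refl
  𝟎≈⊎pathBoundedForm (seq (M ⊕ N)) = inj₂ (seq (M ⊕ N) , ≈refl , [] , pseq (λ ()) , z≤n)
  𝟎≈⊎pathBoundedForm (seq (π · P)) = inj₂ (seq (π · P) , ≈refl , [] , pseq (λ ()) , z≤n)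
  𝟎≈⊎pathBoundedForm (bang M)      = inj₂ (bang M , ≈refl , [] , pbang , z≤n)

  depthAtMost-rootPaths : ∀ {k} P → (∀ ts → RootPath P ts → length ts ≤ k) →
                          DepthAtMost k P
  depthAtMost-rootPaths P bound with 𝟎≈⊎pathBoundedForm P
  ... | inj₁ P≈𝟎 = 𝟎 , ≈sym P≈𝟎 , z≤n
  ... | inj₂ (Q , Q≈P , ts , rp , le) = Q , Q≈P , ≤-trans le (bound ts rp)

  depthAtMost-resp-≈ : ∀ {k} {P Q : Proc B} → P ≈ Q → DepthAtMost k P → DepthAtMost k Q
  depthAtMost-resp-≈ P≈Q (R , R≈P , le) = R , ≈trans R≈P P≈Q , le

module _ (T : Forest) where

  <ᵀ-irreflexive : Irreflexive {A = Node T} _≡_ (_<ᵀ_ T)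
  <ᵀ-irreflexive refl = acyclic T _

  rootPath-length≤ : ∀ {Q} → ForestCompatible T Q →
                     ∀ ts → RootPath Q ts → length ts ≤ size T
  rootPath-length≤ compat ts rp =
    Linked-length≤ (transitive (_⋖_ T)) <ᵀ-irreflexive (compat ts (here rp))

  compatible⇒depthAtMost : ∀ {Q} → Compatible T Q → DepthAtMost (size T) Q
  compatible⇒depthAtMost (Q′ , Q′≈Q , compat) =
    depthAtMost-resp-≈ Q′≈Q (depthAtMost-rootPaths Q′ (rootPath-length≤ compat))

proposition1 : (T : Forest) (P : Proc (Node T)) →
               (∀ Q → Reach P Q → Compatible T Q) →
               DepthBounded P
proposition1 T P compatible =
  size T , λ Q P→*Q → compatible⇒depthAtMost T (compatible Q P→*Q)
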